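{- Let $G=((B,W),E)$ be a leafless bipartite plabic graph whose boundary vertices $1,\dots,n$ are black, and suppose $G$ has an acyclic reverse perfect orientation $\mathcal{O}$. Let $I\subseteq\{1,\dots,n\}$ be the set of boundary vertices that are sources of $\mathcal{O}$. Let $(\mathbf{v},\mathbf{R})=(\{v_b\}_{b\in B},\{r_e\}_{e\in E})$ be an $m$-vector-relation configuration on $G$. Then for every black vertex $b$, $$v_b=\sum_{i\in I}\left(\sum_{P}\frac{\prod_{e}r_e}{\prod_{e'}(-r_{e'})}\right)v_i,$$ where the inner sum is over all directed paths $P$ from $i$ to $b$ in $\mathcal{O}$, the product in the numerator is over the edges $e\in P$ oriented from black to white in $\mathcal{O}$, and the product in the denominator is over the edges $e'\in P$ oriented from white to black in $\mathcal{O}$.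
   Context: A plabic graph is a planar graph embedded in a closed disk, with internal vertices colored black or white, boundary vertices $1,\dots,n$ on the boundary circle (labeled clockwise) each incident to exactly one edge, and every internal vertex joined by a path to some boundary vertex. Leafless means there are no internal leaves except internal vertices adjacent to a boundary vertex. Bipartite: every edge joins a black and a white vertex, where boundary vertices are regarded as black; write $B$ for black vertices (including the boundary ones) and $W$ for white vertices. A reverse perfect orientation is an orientation of all edges such that every internal white vertex has exactly one outgoing edge and every internal black vertex has exactly one incoming edge. An $m$-vector-relation configuration ($m$-VRC) on $G$ is an assignment of a vector $v_b\in\mathbb{C}^m$ to every black vertex $b$ and a scalar $r_e\in\mathbb{C}^*$ to every edge $e$ such that the boundary vectors $v_1,\dots,v_n$ span $\mathbb{C}^m$ and for every white vertex $w$, $\sum_{e=\{w,b\}\in E} r_e v_b=0$. -}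

module Defs where

open import Level using (Level; _⊔_) renaming (suc to lsuc)
open import Algebra.Bundles using (CommutativeRing)
open import Data.Nat using (ℕ; zero; suc; _≤ᵇ_) renaming (_+_ to _+ℕ_; _*_ to _*ℕ_)
open import Data.Nat.DivMod using (m%n<n)
open import Data.Fin using (Fin; toℕ; fromℕ<)
open import Data.Fin.Properties using (_≟_)
open import Data.Bool using (Bool; true; false; if_then_else_; _∧_; _∨_; not)
open import Data.List using (List; []; _∷_; map; concatMap; foldr; allFin; upTo; filter; length)
open import Data.Maybe using (Maybe; just; nothing)
open import Data.Product using (Σ; ∃; _×_; _,_; proj₁; proj₂)
open import Data.Sum using (_⊎_; inj₁; inj₂)
import Data.Sum.Properties as SumP
import Data.Maybe.Properties as MaybeP
open import Relation.Nullary using (¬_; Dec; yes; no; ⌊_⌋)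
open import Relation.Binary.Definitions using (DecidableEquality)
open import Relation.Binary.PropositionalEquality using (_≡_; _≢_)
import Data.List.Relation.Unary.Unique.DecPropositional as UniqueDec

record Field (c ℓ : Level) : Set (lsuc (c ⊔ ℓ)) where
  field
    commutativeRing : CommutativeRing c ℓ
  open CommutativeRing commutativeRing public
  infix 9 _⁻¹
  field
    _⁻¹        : Carrier → Carrier
    0≉1        : ¬ (0# ≈ 1#)
    ⁻¹-inverse : ∀ x → ¬ (x ≈ 0#) → (x * (x ⁻¹)) ≈ 1#

count : ∀ {k} → (Fin k → Bool) → ℕ
count {k} p = length (filter (λ x → Data.Bool.Properties._≟_ (p x) true) (allFin k))
  where import Data.Bool.Properties

allB : ∀ {a} {A : Set a} → (A → Bool) → List A → Bool
allB p = foldr (λ x b → p x ∧ b) true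

iter : ∀ {a} {A : Set a} → (A → A) → ℕ → A → A
iter f zero x = x
iter f (suc j) x = f (iter f j x)

cyc : ∀ {n} → Fin n → Fin n
cyc {suc k} i = fromℕ< (m%n<n (suc (toℕ i)) (suc k))

allSeqs : (e k : ℕ) → List (List (Fin e))
allSeqs e zero = [] ∷ []
allSeqs e (suc k) = concatMap (λ x → map (x ∷_) (allSeqs e k)) (allFin e)

allSeqsUpTo : (e k : ℕ) → List (List (Fin e))
allSeqsUpTo e k = concatMap (allSeqs e) (upTo (suc k))

-- Black vertices B = Fin n ⊎ Fin nb (boundary ⊎ internal black),
-- white vertices W = Fin nw (all internal), edges Fin ne; each edge joins
-- its black end to its white end (so the graph is bipartite; multiple
-- edges are allowed).

record BipGraph (n : ℕ) : Set where
  field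
    nb nw ne : ℕ
    blackEnd : Fin ne → Fin n ⊎ Fin nb
    whiteEnd : Fin ne → Fin nw

module BipGraphDefs {n : ℕ} (G : BipGraph n) where
  open BipGraph G public

  Black : Set
  Black = Fin n ⊎ Fin nb

  Vertex : Set
  Vertex = Black ⊎ Fin nw

  _≟V_ : DecidableEquality Vertex
  _≟V_ = SumP.≡-dec (SumP.≡-dec _≟_ _≟_) _≟_

  bdry : Fin n → Vertex
  bdry i = inj₁ (inj₁ i)

  IsInternal : Vertex → Set
  IsInternal v = ∀ i → v ≢ bdry i

  bEnd : Fin ne → Vertex
  bEnd e = inj₁ (blackEnd e)

  wEnd : Fin ne → Vertex
  wEnd e = inj₂ (whiteEnd e)

  Adjacent : Vertex → Vertex → Set
  Adjacent u v = ∃ λ e → (bEnd e ≡ u × wEnd e ≡ v) ⊎ (wEnd e ≡ u × bEnd e ≡ v)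

  UPath : Vertex → List Vertex → Vertex → Set
  UPath u [] w = u ≡ w
  UPath u (v ∷ vs) w = Adjacent u v × UPath v vs w

  degree : Vertex → ℕ
  degree v = count (λ e → ⌊ bEnd e ≟V v ⌋ ∨ ⌊ wEnd e ≟V v ⌋)

  Leafless : Set
  Leafless = ∀ v → IsInternal v → degree v ≡ 1 → ∃ λ i → Adjacent v (bdry i)

  Dart : Set
  Dart = Fin ne × Bool

  dartVertex : Dart → Vertex
  dartVertex (e , true)  = bEnd e
  dartVertex (e , false) = wEnd e

  -- Planar embedding in a disk, encoded combinatorially.
  -- σ is a rotation system: the counterclockwise cyclic order of the
  -- darts around each vertex.  We add an outer vertex ∞ and new edges
  -- fᵢ = {i , ∞} (i ∈ Fin n); around ∞ the darts of f₁, f₂, …, fₙ follow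
  -- each other counterclockwise (= boundary vertices 1..n clockwise on the
  -- boundary circle of the disk), and at boundary vertex i the rotation is
  -- (eᵢ , fᵢ) where eᵢ is its unique edge.  Augmented darts:
  -- (inj₁ e , s) as before, (inj₂ i , true) = end of fᵢ at i,
  -- (inj₂ i , false) = end of fᵢ at ∞.

  AugDart : Set
  AugDart = (Fin ne ⊎ Fin n) × Bool

  module Aug (bEdge : Fin n → Fin ne) (σ : Dart → Dart) where
    liftD : Dart → AugDart
    liftD (e , s) = (inj₁ e , s)

    σA : AugDart → AugDart
    σA (inj₁ e , true) with blackEnd e
    ... | inj₁ i = (inj₂ i , true)
    ... | inj₂ _ = liftD (σ (e , true))
    σA (inj₁ e , false) = liftD (σ (e , false))
    σA (inj₂ i , true) = (inj₁ (bEdge i) , true)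
    σA (inj₂ i , false) = (inj₂ (cyc i) , false)

    αA : AugDart → AugDart
    αA (x , s) = (x , not s)

    φA : AugDart → AugDart
    φA d = σA (αA d)

    allAug : List AugDart
    allAug = concatMap (λ x → (x , true) ∷ (x , false) ∷ [])
               (map inj₁ (allFin ne) Data.List.++ map inj₂ (allFin n))

    numDarts : ℕ
    numDarts = 2 *ℕ (ne +ℕ n)

    rank : AugDart → ℕ
    rank (inj₁ e , s) = 2 *ℕ toℕ e +ℕ (if s then 1 else 0)
    rank (inj₂ i , s) = 2 *ℕ (ne +ℕ toℕ i) +ℕ (if s then 1 else 0)

    isOrbitMin : AugDart → Bool
    isOrbitMin d = allB (λ j → rank d ≤ᵇ rank (iter φA j d)) (upTo numDarts)

    numFaces : ℕ
    numFaces = length (filter (λ d → Data.Bool.Properties._≟_ (isOrbitMin d) true) allAug)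
      where import Data.Bool.Properties

  -- Directed notions w.r.t. an orientation  bw : Fin ne → Bool
  -- (bw e = true : e oriented from its black end to its white end).

  module Oriented (bw : Fin ne → Bool) where
    tailV : Fin ne → Vertex
    tailV e = if bw e then bEnd e else wEnd e

    headV : Fin ne → Vertex
    headV e = if bw e then wEnd e else bEnd e

    follow : Vertex → List (Fin ne) → Maybe Vertex
    follow u [] = just u
    follow u (e ∷ es) with tailV e ≟V u
    ... | yes _ = follow (headV e) es
    ... | no _  = nothing

    visited : Vertex → List (Fin ne) → List Vertex
    visited u [] = u ∷ []
    visited u (e ∷ es) = u ∷ visited (headV e) es

    IsDirPath : Vertex → Vertex → List (Fin ne) → Set
    IsDirPath u w es = (follow u es ≡ just w) × UniqueDec.Unique _≟V_ (visited u es)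

    isDirPath? : ∀ u w es → Dec (IsDirPath u w es)
    isDirPath? u w es with MaybeP.≡-dec _≟V_ (follow u es) (just w) | UniqueDec.unique? _≟V_ (visited u es)
    ... | yes p | yes q = yes (p , q)
    ... | no ¬p | _     = no (λ r → ¬p (proj₁ r))
    ... | yes _ | no ¬q = no (λ r → ¬q (proj₂ r))

    Acyclic : Set
    Acyclic = ∀ u es → es ≢ [] → follow u es ≢ just u

    isSource : Vertex → Bool
    isSource v = allB (λ e → not ⌊ headV e ≟V v ⌋) (allFin ne)

    IsReversePerfect : Set
    IsReversePerfect =
      (∀ w → count (λ e → ⌊ tailV e ≟V inj₂ w ⌋) ≡ 1) ×
      (∀ b → count (λ e → ⌊ headV e ≟V inj₁ (inj₂ b) ⌋) ≡ 1)

record IsPlabic {n : ℕ} (G : BipGraph n) : Set where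
  open BipGraphDefs G
  field
    bEdge        : Fin n → Fin ne
    bEdge-end    : ∀ i → blackEnd (bEdge i) ≡ inj₁ i
    bEdge-uniq   : ∀ i e → blackEnd e ≡ inj₁ i → e ≡ bEdge i
    connected    : ∀ v → IsInternal v → ∃ λ i → ∃ λ vs → UPath v vs (bdry i)
    -- planar embedding: a rotation system (permutation of the darts whose
    -- orbits are exactly the sets of darts at a common vertex) ...
    σ            : Dart → Dart
    σ⁻¹          : Dart → Dart
    σσ⁻¹         : ∀ d → σ (σ⁻¹ d) ≡ d
    σ⁻¹σ         : ∀ d → σ⁻¹ (σ d) ≡ d
    σ-vertex     : ∀ d → dartVertex (σ d) ≡ dartVertex d
    σ-transitive : ∀ d d' → dartVertex d ≡ dartVertex d' → ∃ λ j → iter σ j d ≡ d'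
    -- ... such that the map augmented by the outer vertex ∞ (see Aug) has
    -- genus 0, i.e. Euler's formula V + F = E + 2 (the augmented map is
    -- connected by `connected`); for n = 0 the graph is empty.
    planar       : n ≡ 0 ⊎ (n +ℕ nb +ℕ nw +ℕ 1 +ℕ Aug.numFaces bEdge σ ≡ ne +ℕ n +ℕ 2)

module _ {c ℓ : Level} (K : Field c ℓ) where
  open Field K

  sumL : ∀ {a} {A : Set a} → (A → Carrier) → List A → Carrier
  sumL f = foldr (λ x s → f x + s) 0#

  prodL : ∀ {a} {A : Set a} → (A → Carrier) → List A → Carrier
  prodL f = foldr (λ x s → f x * s) 1#

  record VRC (m : ℕ) {n : ℕ} (G : BipGraph n) : Set (c ⊔ ℓ) where
    open BipGraphDefs G
    field
      vec        : Black → Fin m → Carrier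
      rel        : Fin ne → Carrier
      rel-nonzero : ∀ e → ¬ (rel e ≈ 0#)
      spanning   : ∀ (u : Fin m → Carrier) → ∃ λ (a : Fin n → Carrier) →
                     ∀ k → u k ≈ sumL (λ i → a i * vec (inj₁ i) k) (allFin n)
      white-rel  : ∀ w k → sumL (λ e → if ⌊ whiteEnd e ≟ w ⌋ then rel e * vec (blackEnd e) k else 0#)
                             (allFin ne) ≈ 0#

  module PathWeights {n : ℕ} (G : BipGraph n) (bw : Fin (BipGraph.ne G) → Bool)
                     (r : Fin (BipGraph.ne G) → Carrier) where
    open BipGraphDefs G
    open Oriented bw

    weight : List (Fin ne) → Carrier
    weight es = prodL (λ e → if bw e then r e else 1#) es
              * (prodL (λ e → if bw e then 1# else - r e) es) ⁻¹

    -- A directed path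
    -- uses distinct edges, so it has at most ne edges; we enumerate all edge
    -- sequences of length ≤ ne, each exactly once.
    pathSum : Vertex → Vertex → Carrier
    pathSum u w = sumL (λ es → if ⌊ isDirPath? u w es ⌋ then weight es else 0#) (allSeqsUpTo ne ne)

{-# OPTIONS --safe #-}
module Submission where

-- Fix b and let T v be the sum over directed paths P from v to b of Π_{e ∈ P} w_e, where
-- w_e = r_e on black-to-white edges and w_e = 1/(-r_e) on white-to-black ones; put U v = v_c at a
-- black vertex c and U v = 0 at a white one.  Splitting a path at its first edge gives
-- T u = [u = b] + Σ_{e out of u} w_e T(head e); acyclicity makes every walk a path with at most
-- |E| edges, so this recursion is exact.  Summing T·U over all vertices along outgoing edges gives
-- v_b + Σ_e w_e T(head e) U(tail e); summing along incoming edges, using that every black vertex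
-- except the boundary sources has exactly one incoming edge, gives
-- Σ_{i ∈ I} T(i) v_i + Σ_e T(head e) U(head e).  Edge by edge the two edge sums differ by
-- T(white end) r_e v(black end) (a white vertex w with its unique outgoing edge e has
-- T(w) = T(head e)/(-r_e)), and these terms sum to zero by the white relations.

open import Defs
open import Level using (Level)
open import Algebra.Bundles using (CommutativeSemiring)
open import Data.Nat using (ℕ; zero; suc; _≤_)
import Data.Nat.Properties as ℕ
open import Data.Fin using (Fin; zero; suc)
import Data.Fin.Properties as Fin
open import Data.Bool using (Bool; true; false; if_then_else_; not)
import Data.Bool.Properties as Bool
open import Data.List
  using (List; []; _∷_; map; concatMap; foldr; _++_; _∷ʳ_; filter; length; lookup; allFin; upTo; applyUpTo)
import Data.List.Properties as List
open import Data.List.Membership.Propositional using (_∈_; _∉_)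
open import Data.List.Membership.Propositional.Properties
  using (∈-allFin; ∈-lookup; ∈-filter⁺; ∈-filter⁻; ∈-map⁺; ∈-map⁻; ∈-++⁺ˡ; ∈-++⁺ʳ)
open import Data.List.Relation.Unary.Any using (here; there)
open import Data.List.Relation.Unary.All as All using ([])
open import Data.List.Relation.Unary.All.Properties using (¬Any⇒All¬)
open import Data.List.Relation.Unary.AllPairs using ([]; _∷_)
open import Data.List.Relation.Unary.Unique.Propositional using (Unique)
import Data.List.Relation.Unary.Unique.Propositional.Properties as Unique
open import Data.Maybe using (just; nothing)
import Data.Maybe.Properties as Maybe
open import Data.Empty using (⊥)
open import Data.Product using (∃; _×_; _,_; proj₁; proj₂)
open import Data.Sum using (inj₁; inj₂)
import Data.Sum.Properties as Sum
open import Function using (_∘_)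
open import Relation.Nullary using (¬_; Dec; yes; no; ⌊_⌋; contradiction)
open import Relation.Unary using (Pred; Decidable)
open import Relation.Binary.Definitions using (DecidableEquality)
open import Relation.Binary.PropositionalEquality as ≡ using (_≡_; _≢_)

lookup-injective : ∀ {a} {A : Set a} {xs : List A} → Unique xs →
                   ∀ {i j} → lookup xs i ≡ lookup xs j → i ≡ j
lookup-injective (x∉xs ∷ !xs) {zero}  {zero}  eq = ≡.refl
lookup-injective (x∉xs ∷ !xs) {zero}  {suc j} eq = contradiction eq (All.lookup x∉xs (∈-lookup j))
lookup-injective (x∉xs ∷ !xs) {suc i} {zero}  eq = contradiction (≡.sym eq) (All.lookup x∉xs (∈-lookup i))
lookup-injective (x∉xs ∷ !xs) {suc i} {suc j} eq = ≡.cong suc (lookup-injective !xs eq)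

unique⇒length≤ : ∀ {k} {xs : List (Fin k)} → Unique xs → length xs ≤ k
unique⇒length≤ !xs = Fin.injective⇒≤ (lookup-injective !xs)

module _ {a b} {A : Set a} {B : Set b} {xs : List A} {ys : List B} where

  inj-++-unique : Unique xs → Unique ys → Unique (map inj₁ xs ++ map inj₂ ys)
  inj-++-unique !xs !ys =
    Unique.++⁺ (Unique.map⁺ Sum.inj₁-injective !xs) (Unique.map⁺ Sum.inj₂-injective !ys) disjoint
    where
    disjoint : ∀ {z} → z ∈ map inj₁ xs × z ∈ map inj₂ ys → ⊥
    disjoint (z∈₁ , z∈₂) with ∈-map⁻ inj₁ z∈₁ | ∈-map⁻ inj₂ z∈₂
    ... | _ , _ , ≡.refl | _ , _ , ()

  ∈-inj-++ : (∀ x → x ∈ xs) → (∀ y → y ∈ ys) → ∀ z → z ∈ map inj₁ xs ++ map inj₂ ys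
  ∈-inj-++ ∈xs ∈ys (inj₁ x) = ∈-++⁺ˡ (∈-map⁺ inj₁ (∈xs x))
  ∈-inj-++ ∈xs ∈ys (inj₂ y) = ∈-++⁺ʳ _ (∈-map⁺ inj₂ (∈ys y))

module _ {k p} {P : Pred (Fin k) p} (P? : Decidable P) where

  private
    Q? : Decidable (λ x → ⌊ P? x ⌋ ≡ true)
    Q? x = ⌊ P? x ⌋ Bool.≟ true

    witness : ∀ {x} (d : Dec (P x)) → ⌊ d ⌋ ≡ true → P x
    witness (yes Px) _ = Px

    certify : ∀ {x} (d : Dec (P x)) → P x → ⌊ d ⌋ ≡ true
    certify (yes _)  _  = ≡.refl
    certify (no ¬Px) Px = contradiction Px ¬Px

  count≡1⇒∃! : count (λ x → ⌊ P? x ⌋) ≡ 1 → ∃ λ z → P z × ∀ {x} → P x → x ≡ z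
  count≡1⇒∃! count≡1 with filter Q? (allFin k) in eq
  ... | z ∷ [] = z , witness (P? z) (proj₂ (∈-filter⁻ Q? {xs = allFin k} z∈)) , only
    where
    z∈ : z ∈ filter Q? (allFin k)
    z∈ = ≡.subst (z ∈_) (≡.sym eq) (here ≡.refl)
    only : ∀ {x} → P x → x ≡ z
    only {x} Px with ≡.subst (x ∈_) eq (∈-filter⁺ Q? {xs = allFin k} (∈-allFin x) (certify (P? x) Px))
    ... | here x≡z = x≡z

module _ {a} {A : Set a} (p : A → Bool) where

  allB-true : ∀ {xs x} → allB p xs ≡ true → x ∈ xs → p x ≡ true
  allB-true {y ∷ ys} all-p x∈ with p y in py
  allB-true {y ∷ ys} all-p (here ≡.refl) | true = py
  allB-true {y ∷ ys} all-p (there x∈) | true = allB-true all-p x∈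

  allB-false : ∀ xs → allB p xs ≡ false → ∃ λ x → p x ≡ false
  allB-false (y ∷ ys) ¬all-p with p y in py
  ... | true  = allB-false ys ¬all-p
  ... | false = y , py

module ListSums {c ℓ : Level} (R : CommutativeSemiring c ℓ) where
  open CommutativeSemiring R
  open import Relation.Binary.Reasoning.Setoid setoid

  private
    variable
      a p : Level
      A B : Set a
      f g : A → Carrier

  Σ : (A → Carrier) → List A → Carrier
  Σ f = foldr (λ x s → f x + s) 0#

  ite : Bool → Carrier → Carrier
  ite β x = if β then x else 0#

  Σ-cong : ∀ xs → (∀ x → f x ≈ g x) → Σ f xs ≈ Σ g xs
  Σ-cong []       f≈g = refl
  Σ-cong (x ∷ xs) f≈g = +-cong (f≈g x) (Σ-cong xs f≈g)

  Σ-zero : ∀ xs → (∀ x → f x ≈ 0#) → Σ f xs ≈ 0#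
  Σ-zero []       f≈0 = refl
  Σ-zero (x ∷ xs) f≈0 = trans (+-cong (f≈0 x) (Σ-zero xs f≈0)) (+-identityˡ 0#)

  Σ-+ : ∀ xs → Σ (λ x → f x + g x) xs ≈ Σ f xs + Σ g xs
  Σ-+ []       = sym (+-identityˡ 0#)
  Σ-+ {f = f} {g = g} (x ∷ xs) = begin
    (f x + g x) + Σ (λ x → f x + g x) xs ≈⟨ +-congˡ (Σ-+ xs) ⟩
    (f x + g x) + (Σ f xs + Σ g xs)      ≈⟨ interchange (f x) (g x) _ _ ⟩
    (f x + Σ f xs) + (g x + Σ g xs)      ∎
    where open import Algebra.Properties.CommutativeSemigroup +-commutativeSemigroup using (interchange)

  Σ-*ˡ : ∀ z xs → z * Σ f xs ≈ Σ (λ x → z * f x) xs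
  Σ-*ˡ z []       = zeroʳ z
  Σ-*ˡ z (x ∷ xs) = trans (distribˡ z _ _) (+-congˡ (Σ-*ˡ z xs))

  Σ-*ʳ : ∀ z xs → Σ f xs * z ≈ Σ (λ x → f x * z) xs
  Σ-*ʳ z []       = zeroˡ z
  Σ-*ʳ z (x ∷ xs) = trans (distribʳ z _ _) (+-congˡ (Σ-*ʳ z xs))

  Σ-++ : ∀ xs ys → Σ f (xs ++ ys) ≈ Σ f xs + Σ f ys
  Σ-++ []       ys = sym (+-identityˡ _)
  Σ-++ (x ∷ xs) ys = trans (+-congˡ (Σ-++ xs ys)) (sym (+-assoc _ _ _))

  Σ-map : ∀ (h : A → B) xs → Σ f (map h xs) ≡ Σ (f ∘ h) xs
  Σ-map h []       = ≡.refl
  Σ-map h (x ∷ xs) = ≡.cong (_ +_) (Σ-map h xs)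

  Σ-inj-++ : ∀ xs ys → Σ f (map inj₁ xs ++ map inj₂ ys) ≈ Σ (f ∘ inj₁) xs + Σ (f ∘ inj₂) ys
  Σ-inj-++ xs ys =
    trans (Σ-++ (map inj₁ xs) (map inj₂ ys)) (reflexive (≡.cong₂ _+_ (Σ-map inj₁ xs) (Σ-map inj₂ ys)))

  Σ-concatMap : ∀ (h : A → List B) xs → Σ f (concatMap h xs) ≈ Σ (λ x → Σ f (h x)) xs
  Σ-concatMap h []       = refl
  Σ-concatMap h (x ∷ xs) = trans (Σ-++ (h x) (concatMap h xs)) (+-congˡ (Σ-concatMap h xs))

  Σ-swap : ∀ (F : A → B → Carrier) xs ys →
           Σ (λ x → Σ (F x) ys) xs ≈ Σ (λ y → Σ (λ x → F x y) xs) ys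
  Σ-swap F []       ys = sym (Σ-zero ys (λ _ → refl))
  Σ-swap F (x ∷ xs) ys = trans (+-congˡ (Σ-swap F xs ys)) (sym (Σ-+ ys))

  Σ-upTo-suc : ∀ n → Σ f (upTo (suc n)) ≈ f 0 + Σ (f ∘ suc) (upTo n)
  Σ-upTo-suc {f = f} n = +-congˡ (begin
    Σ f (applyUpTo suc n)    ≡⟨ ≡.cong (Σ f) (List.map-applyUpTo (λ i → i) suc n) ⟨
    Σ f (map suc (upTo n))   ≡⟨ Σ-map suc (upTo n) ⟩
    Σ (f ∘ suc) (upTo n)     ∎)

  Σ-upTo-∷ʳ : ∀ n → Σ f (upTo (suc n)) ≈ Σ f (upTo n) + f n
  Σ-upTo-∷ʳ {f = f} n = begin
    Σ f (upTo (suc n))     ≡⟨ ≡.cong (Σ f) (List.upTo-∷ʳ n) ⟨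
    Σ f (upTo n ∷ʳ n)      ≈⟨ Σ-++ (upTo n) (n ∷ []) ⟩
    Σ f (upTo n) + (f n + 0#) ≈⟨ +-congˡ (+-identityʳ (f n)) ⟩
    Σ f (upTo n) + f n     ∎

  ite-cong : ∀ β {x y} → x ≈ y → ite β x ≈ ite β y
  ite-cong true  x≈y = x≈y
  ite-cong false x≈y = refl

  ite-≈0 : ∀ β {x} → x ≈ 0# → ite β x ≈ 0#
  ite-≈0 true  x≈0 = x≈0
  ite-≈0 false x≈0 = refl

  ite-*ˡ : ∀ β z x → z * ite β x ≈ ite β (z * x)
  ite-*ˡ true  z x = refl
  ite-*ˡ false z x = zeroʳ z

  ite-*ʳ : ∀ β z x → ite β x * z ≈ ite β (x * z)
  ite-*ʳ true  z x = refl
  ite-*ʳ false z x = zeroˡ z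

  Σ-ite-*ˡ : ∀ β z xs → Σ (λ x → ite β (z * f x)) xs ≈ ite β (z * Σ f xs)
  Σ-ite-*ˡ true  z xs = sym (Σ-*ˡ z xs)
  Σ-ite-*ˡ false z xs = Σ-zero xs (λ _ → refl)

  Σ-allSeqs-suc : ∀ {e} (F : List (Fin e) → Carrier) j →
                  Σ F (allSeqs e (suc j)) ≈ Σ (λ x → Σ (F ∘ (x ∷_)) (allSeqs e j)) (allFin e)
  Σ-allSeqs-suc {e} F j =
    trans (Σ-concatMap _ (allFin e)) (Σ-cong (allFin e) (λ x → reflexive (Σ-map (x ∷_) (allSeqs e j))))

  Σ-allSeqs-≈0 : ∀ {e} (F : List (Fin e) → Carrier) j →
                 (∀ es → length es ≡ j → F es ≈ 0#) → Σ F (allSeqs e j) ≈ 0#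
  Σ-allSeqs-≈0 F zero    F≈0 = trans (+-identityʳ _) (F≈0 [] ≡.refl)
  Σ-allSeqs-≈0 {e} F (suc j) F≈0 = trans (Σ-allSeqs-suc F j)
    (Σ-zero (allFin e) (λ x → Σ-allSeqs-≈0 (F ∘ (x ∷_)) j (λ es len → F≈0 (x ∷ es) (≡.cong suc len))))

  module _ {P : Pred A p} (P? : Decidable P) where

    Σ-ite-none : ∀ xs → (∀ {x} → x ∈ xs → ¬ P x) → Σ (λ x → ite ⌊ P? x ⌋ (f x)) xs ≈ 0#
    Σ-ite-none []       ¬P = refl
    Σ-ite-none (x ∷ xs) ¬P with P? x
    ... | yes Px = contradiction Px (¬P (here ≡.refl))
    ... | no  _  = trans (+-identityˡ _) (Σ-ite-none xs (¬P ∘ there))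

    Σ-ite-single : ∀ {z xs} → Unique xs → z ∈ xs → P z → (∀ {x} → P x → x ≡ z) →
                   Σ (λ x → ite ⌊ P? x ⌋ (f x)) xs ≈ f z
    Σ-ite-single {xs = x ∷ xs} (x∉xs ∷ !xs) z∈ Pz only-z with P? x
    ... | yes Px with ≡.refl ← only-z Px =
      trans (+-congˡ (Σ-ite-none xs (λ y∈ Py → All.lookup x∉xs y∈ (≡.sym (only-z Py))))) (+-identityʳ _)
    ... | no ¬Px with z∈
    ...   | here ≡.refl = contradiction Pz ¬Px
    ...   | there z∈xs  = trans (+-identityˡ _) (Σ-ite-single !xs z∈xs Pz only-z)

  Σ-fibres : ∀ (h : A → B) (_≟_ : DecidableEquality B) (F : A → B → Carrier) xs {ys} →
             Unique ys → (∀ x → h x ∈ ys) →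
             Σ (λ y → Σ (λ x → ite ⌊ h x ≟ y ⌋ (F x y)) xs) ys ≈ Σ (λ x → F x (h x)) xs
  Σ-fibres h _≟_ F xs {ys} !ys h∈ys = begin
    Σ (λ y → Σ (λ x → ite ⌊ h x ≟ y ⌋ (F x y)) xs) ys
      ≈⟨ Σ-swap (λ y x → ite ⌊ h x ≟ y ⌋ (F x y)) ys xs ⟩
    Σ (λ x → Σ (λ y → ite ⌊ h x ≟ y ⌋ (F x y)) ys) xs
      ≈⟨ Σ-cong xs (λ x → Σ-ite-single (h x ≟_) !ys (h∈ys x) ≡.refl ≡.sym) ⟩
    Σ (λ x → F x (h x)) xs ∎

module FieldProperties {c ℓ : Level} (K : Field c ℓ) where
  open Field K
  open import Algebra.Properties.Ring ring using (-‿distribˡ-*; -‿involutive; -0#≈0#)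
  open import Algebra.Properties.CommutativeSemigroup *-commutativeSemigroup using (interchange)
  open import Relation.Binary.Reasoning.Setoid setoid

  x⁻¹*x≈1 : ∀ {x} → x ≉ 0# → x ⁻¹ * x ≈ 1#
  x⁻¹*x≈1 {x} x≉0 = trans (*-comm _ x) (⁻¹-inverse x x≉0)

  ⁻¹-unique : ∀ {x y} → x ≉ 0# → x * y ≈ 1# → y ≈ x ⁻¹
  ⁻¹-unique {x} {y} x≉0 xy≈1 = begin
    y                ≈⟨ *-identityˡ y ⟨
    1# * y           ≈⟨ *-congʳ (x⁻¹*x≈1 x≉0) ⟨
    (x ⁻¹ * x) * y   ≈⟨ *-assoc _ x y ⟩
    x ⁻¹ * (x * y)   ≈⟨ *-congˡ xy≈1 ⟩
    x ⁻¹ * 1#        ≈⟨ *-identityʳ _ ⟩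
    x ⁻¹             ∎

  *-≉0 : ∀ {x y} → x ≉ 0# → y ≉ 0# → x * y ≉ 0#
  *-≉0 {x} {y} x≉0 y≉0 xy≈0 = y≉0 (begin
    y                ≈⟨ *-identityˡ y ⟨
    1# * y           ≈⟨ *-congʳ (x⁻¹*x≈1 x≉0) ⟨
    (x ⁻¹ * x) * y   ≈⟨ *-assoc _ x y ⟩
    x ⁻¹ * (x * y)   ≈⟨ *-congˡ xy≈0 ⟩
    x ⁻¹ * 0#        ≈⟨ zeroʳ _ ⟩
    0#               ∎)

  ⁻¹-distrib-* : ∀ {x y} → x ≉ 0# → y ≉ 0# → (x * y) ⁻¹ ≈ x ⁻¹ * y ⁻¹
  ⁻¹-distrib-* {x} {y} x≉0 y≉0 = sym (⁻¹-unique (*-≉0 x≉0 y≉0) (begin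
    (x * y) * (x ⁻¹ * y ⁻¹)     ≈⟨ interchange x y _ _ ⟩
    (x * x ⁻¹) * (y * y ⁻¹)     ≈⟨ *-cong (⁻¹-inverse x x≉0) (⁻¹-inverse y y≉0) ⟩
    1# * 1#                     ≈⟨ *-identityˡ 1# ⟩
    1#                          ∎))

  1≉0 : 1# ≉ 0#
  1≉0 1≈0 = 0≉1 (sym 1≈0)

  1⁻¹≈1 : 1# ⁻¹ ≈ 1#
  1⁻¹≈1 = sym (⁻¹-unique 1≉0 (*-identityˡ 1#))

  -‿≉0 : ∀ {x} → x ≉ 0# → - x ≉ 0#
  -‿≉0 {x} x≉0 -x≈0 = x≉0 (trans (sym (-‿involutive x)) (trans (-‿cong -x≈0) -0#≈0#))

  x*[-x]⁻¹≈-1 : ∀ {x} → x ≉ 0# → x * (- x) ⁻¹ ≈ - 1#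
  x*[-x]⁻¹≈-1 {x} x≉0 = begin
    x * (- x) ⁻¹          ≈⟨ *-congʳ (-‿involutive x) ⟨
    - (- x) * (- x) ⁻¹    ≈⟨ -‿distribˡ-* (- x) _ ⟨
    - ((- x) * (- x) ⁻¹)  ≈⟨ -‿cong (⁻¹-inverse (- x) (-‿≉0 x≉0)) ⟩
    - 1#                  ∎

module Orientation {n : ℕ} (G : BipGraph n) (bw : Fin (BipGraph.ne G) → Bool) where
  open BipGraphDefs G
  open ≡ using (refl; sym; trans; cong)
  open Oriented bw

  Reachable : Vertex → Vertex → Set
  Reachable u v = ∃ λ es → follow u es ≡ just v

  follow-∷ : ∀ {u e} es → tailV e ≡ u → follow u (e ∷ es) ≡ follow (headV e) es
  follow-∷ {u} {e} es tail≡u with tailV e ≟V u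
  ... | yes _       = refl
  ... | no  tail≢u  = contradiction tail≡u tail≢u

  follow-∷-nothing : ∀ {u e} es → tailV e ≢ u → follow u (e ∷ es) ≡ nothing
  follow-∷-nothing {u} {e} es tail≢u with tailV e ≟V u
  ... | yes tail≡u = contradiction tail≡u tail≢u
  ... | no  _      = refl

  follow-∷-tail : ∀ {u w e} es → follow u (e ∷ es) ≡ just w → tailV e ≡ u
  follow-∷-tail {u} {e = e} es walk with tailV e ≟V u
  ... | yes tail≡u = tail≡u

  follow-∷-rest : ∀ {u w e} es → follow u (e ∷ es) ≡ just w → follow (headV e) es ≡ just w
  follow-∷-rest es walk = trans (sym (follow-∷ es (follow-∷-tail es walk))) walk

  visited-reachable : ∀ {u w v} es → follow u es ≡ just w → v ∈ visited u es → Reachable u v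
  visited-reachable []       walk (here refl) = [] , refl
  visited-reachable (e ∷ es) walk (here refl) = [] , refl
  visited-reachable (e ∷ es) walk (there v∈)
    with as , reach ← visited-reachable es (follow-∷-rest es walk) v∈
       = e ∷ as , trans (follow-∷ as (follow-∷-tail es walk)) reach

  tail-visited : ∀ {u w e} es → follow u es ≡ just w → e ∈ es → tailV e ∈ visited u es
  tail-visited (e ∷ es) walk (here refl) = here (follow-∷-tail es walk)
  tail-visited (e ∷ es) walk (there e∈)  = there (tail-visited es (follow-∷-rest es walk) e∈)

  head-black : ∀ {e c} → headV e ≡ inj₁ c → blackEnd e ≡ c
  head-black {e} head≡c with bw e
  ... | false = Sum.inj₁-injective head≡c

  source⇒no-in-edge : ∀ {v} → isSource v ≡ true → ∀ e → headV e ≢ v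
  source⇒no-in-edge {v} source e head≡v
    with headV e ≟V v | allB-true (λ e → not ⌊ headV e ≟V v ⌋) source (∈-allFin e)
  ... | yes _     | ()
  ... | no head≢v | _  = head≢v head≡v

  non-source⇒in-edge : ∀ {v} → isSource v ≡ false → ∃ λ e → headV e ≡ v
  non-source⇒in-edge {v} non-source
    with e , not-in ← allB-false (λ e → not ⌊ headV e ≟V v ⌋) (allFin ne) non-source
    with headV e ≟V v | not-in
  ... | yes head≡v | _ = e , head≡v

  module _ (acyclic : Acyclic) where

    tail-unreachable-from-head : ∀ e → ¬ Reachable (headV e) (tailV e)
    tail-unreachable-from-head e (as , reach) = acyclic (tailV e) (e ∷ as) (λ ()) (trans (follow-∷ as refl) reach)

    walk-visited-unique : ∀ {u w} es → follow u es ≡ just w → Unique (visited u es)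
    walk-visited-unique []       walk = [] ∷ []
    walk-visited-unique {u} (e ∷ es) walk =
      ¬Any⇒All¬ _ u∉ ∷ walk-visited-unique es (follow-∷-rest es walk)
      where
      u∉ : u ∉ visited (headV e) es
      u∉ u∈ with refl ← follow-∷-tail es walk =
        tail-unreachable-from-head e (visited-reachable es (follow-∷-rest es walk) u∈)

    walk-edges-unique : ∀ {u w} es → follow u es ≡ just w → Unique es
    walk-edges-unique []       walk = []
    walk-edges-unique (e ∷ es) walk =
      ¬Any⇒All¬ es e∉ ∷ walk-edges-unique es (follow-∷-rest es walk)
      where
      e∉ : e ∉ es
      e∉ e∈ = tail-unreachable-from-head e
        (visited-reachable es (follow-∷-rest es walk) (tail-visited es (follow-∷-rest es walk) e∈))

    walk-length≤ : ∀ {u w} es → follow u es ≡ just w → length es ≤ ne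
    walk-length≤ es walk = unique⇒length≤ (walk-edges-unique es walk)

module PathSums {c ℓ : Level} (K : Field c ℓ) {n : ℕ} (G : BipGraph n)
                (bw : Fin (BipGraph.ne G) → Bool)
                (r : Fin (BipGraph.ne G) → Field.Carrier K)
                (r≉0 : ∀ e → Field._≉_ K (r e) (Field.0# K))
                (acyclic : BipGraphDefs.Oriented.Acyclic G bw) where
  open Field K
  open FieldProperties K
  open ListSums commutativeSemiring
  open BipGraphDefs G
  open Oriented bw
  open PathWeights K G bw r
  open Orientation G bw
  open import Relation.Binary.Reasoning.Setoid setoid

  edgeWeight : Fin ne → Carrier
  edgeWeight e = if bw e then r e else (- r e) ⁻¹

  private
    numeratorFactor denominatorFactor : Fin ne → Carrier
    numeratorFactor   e = if bw e then r e else 1#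
    denominatorFactor e = if bw e then 1# else - r e

    denominatorFactor≉0 : ∀ e → denominatorFactor e ≉ 0#
    denominatorFactor≉0 e with bw e
    ... | true  = 1≉0
    ... | false = -‿≉0 (r≉0 e)

    denominator≉0 : ∀ es → prodL K denominatorFactor es ≉ 0#
    denominator≉0 []       = 1≉0
    denominator≉0 (e ∷ es) = *-≉0 (denominatorFactor≉0 e) (denominator≉0 es)

    edgeWeight-factors : ∀ e → numeratorFactor e * denominatorFactor e ⁻¹ ≈ edgeWeight e
    edgeWeight-factors e with bw e
    ... | true  = trans (*-congˡ 1⁻¹≈1) (*-identityʳ _)
    ... | false = *-identityˡ _

  weight-[] : weight [] ≈ 1#
  weight-[] = trans (*-identityˡ _) 1⁻¹≈1

  weight-∷ : ∀ e es → weight (e ∷ es) ≈ edgeWeight e * weight es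
  weight-∷ e es = begin
    (numeratorFactor e * N) * (denominatorFactor e * D) ⁻¹
      ≈⟨ *-congˡ (⁻¹-distrib-* (denominatorFactor≉0 e) (denominator≉0 es)) ⟩
    (numeratorFactor e * N) * (denominatorFactor e ⁻¹ * D ⁻¹)
      ≈⟨ interchange _ _ _ _ ⟩
    (numeratorFactor e * denominatorFactor e ⁻¹) * (N * D ⁻¹)
      ≈⟨ *-congʳ (edgeWeight-factors e) ⟩
    edgeWeight e * weight es ∎
    where
    open import Algebra.Properties.CommutativeSemigroup *-commutativeSemigroup using (interchange)
    N = prodL K numeratorFactor es
    D = prodL K denominatorFactor es

  pathTerm : Vertex → Vertex → List (Fin ne) → Carrier
  pathTerm u w es = if ⌊ isDirPath? u w es ⌋ then weight es else 0#

  pathTerm-walk : ∀ {u w} es → follow u es ≡ just w → pathTerm u w es ≈ weight es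
  pathTerm-walk {u} {w} es walk with isDirPath? u w es
  ... | yes _       = refl
  ... | no  ¬path   = contradiction (walk , walk-visited-unique acyclic es walk) ¬path

  pathTerm-nonwalk : ∀ {u w} es → follow u es ≢ just w → pathTerm u w es ≈ 0#
  pathTerm-nonwalk {u} {w} es ¬walk with isDirPath? u w es
  ... | yes path = contradiction (proj₁ path) ¬walk
  ... | no  _    = refl

  pathTerm-[] : ∀ u w → pathTerm u w [] ≈ ite ⌊ u ≟V w ⌋ 1#
  pathTerm-[] u w = by-cases (u ≟V w)
    where
    by-cases : (u≟w : Dec (u ≡ w)) → pathTerm u w [] ≈ ite ⌊ u≟w ⌋ 1#
    by-cases (yes ≡.refl) = trans (pathTerm-walk [] ≡.refl) weight-[]
    by-cases (no  u≢w)    = pathTerm-nonwalk [] (u≢w ∘ Maybe.just-injective)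

  pathTerm-∷ : ∀ u w e es →
               pathTerm u w (e ∷ es) ≈ ite ⌊ tailV e ≟V u ⌋ (edgeWeight e * pathTerm (headV e) w es)
  pathTerm-∷ u w e es = by-cases (tailV e ≟V u) (Maybe.≡-dec _≟V_ (follow (headV e) es) (just w))
    where
    by-cases : (tail≟u : Dec (tailV e ≡ u)) → Dec (follow (headV e) es ≡ just w) →
               pathTerm u w (e ∷ es) ≈ ite ⌊ tail≟u ⌋ (edgeWeight e * pathTerm (headV e) w es)
    by-cases (no tail≢u) _ = pathTerm-nonwalk (e ∷ es) λ walk →
      contradiction (≡.trans (≡.sym (follow-∷-nothing es tail≢u)) walk) λ ()
    by-cases (yes tail≡u) (yes walk) = begin
      pathTerm u w (e ∷ es)                   ≈⟨ pathTerm-walk (e ∷ es) (≡.trans (follow-∷ es tail≡u) walk) ⟩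
      weight (e ∷ es)                         ≈⟨ weight-∷ e es ⟩
      edgeWeight e * weight es                ≈⟨ *-congˡ (pathTerm-walk es walk) ⟨
      edgeWeight e * pathTerm (headV e) w es  ∎
    by-cases (yes tail≡u) (no ¬walk) = begin
      pathTerm u w (e ∷ es)                   ≈⟨ pathTerm-nonwalk (e ∷ es) (¬walk ∘ ≡.trans (≡.sym (follow-∷ es tail≡u))) ⟩
      0#                                      ≈⟨ zeroʳ _ ⟨
      edgeWeight e * 0#                       ≈⟨ *-congˡ (pathTerm-nonwalk es ¬walk) ⟨
      edgeWeight e * pathTerm (headV e) w es  ∎

  lengthSum : ℕ → Vertex → Vertex → Carrier
  lengthSum j u w = Σ (pathTerm u w) (allSeqs ne j)

  lengthSum-zero : ∀ u w → lengthSum 0 u w ≈ ite ⌊ u ≟V w ⌋ 1#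
  lengthSum-zero u w = trans (+-identityʳ _) (pathTerm-[] u w)

  lengthSum-suc : ∀ j u w → lengthSum (suc j) u w ≈
                  Σ (λ e → ite ⌊ tailV e ≟V u ⌋ (edgeWeight e * lengthSum j (headV e) w)) (allFin ne)
  lengthSum-suc j u w = begin
    lengthSum (suc j) u w
      ≈⟨ Σ-allSeqs-suc (pathTerm u w) j ⟩
    Σ (λ e → Σ (λ es → pathTerm u w (e ∷ es)) (allSeqs ne j)) (allFin ne)
      ≈⟨ Σ-cong (allFin ne) (λ e → Σ-cong (allSeqs ne j) (pathTerm-∷ u w e)) ⟩
    Σ (λ e → Σ (λ es → ite ⌊ tailV e ≟V u ⌋ (edgeWeight e * pathTerm (headV e) w es)) (allSeqs ne j)) (allFin ne)
      ≈⟨ Σ-cong (allFin ne) (λ e → Σ-ite-*ˡ ⌊ tailV e ≟V u ⌋ (edgeWeight e) (allSeqs ne j)) ⟩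
    Σ (λ e → ite ⌊ tailV e ≟V u ⌋ (edgeWeight e * lengthSum j (headV e) w)) (allFin ne) ∎

  lengthSum-too-long : ∀ u w → lengthSum (suc ne) u w ≈ 0#
  lengthSum-too-long u w = Σ-allSeqs-≈0 (pathTerm u w) (suc ne) λ es len →
    pathTerm-nonwalk es λ walk → ℕ.n≮n ne (≡.subst (_≤ ne) len (walk-length≤ acyclic es walk))

  pathSum≈Σ-lengthSum : ∀ u w → pathSum u w ≈ Σ (λ j → lengthSum j u w) (upTo (suc ne))
  pathSum≈Σ-lengthSum u w = Σ-concatMap (allSeqs ne) (upTo (suc ne))

  Σ-lengthSum-suc : ∀ u w → Σ (λ j → lengthSum (suc j) u w) (upTo (suc ne)) ≈
                    Σ (λ e → ite ⌊ tailV e ≟V u ⌋ (edgeWeight e * pathSum (headV e) w)) (allFin ne)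
  Σ-lengthSum-suc u w = begin
    Σ (λ j → lengthSum (suc j) u w) (upTo (suc ne))
      ≈⟨ Σ-cong (upTo (suc ne)) (λ j → lengthSum-suc j u w) ⟩
    Σ (λ j → Σ (λ e → ite (out e) (edgeWeight e * lengthSum j (headV e) w)) (allFin ne)) (upTo (suc ne))
      ≈⟨ Σ-swap _ (upTo (suc ne)) (allFin ne) ⟩
    Σ (λ e → Σ (λ j → ite (out e) (edgeWeight e * lengthSum j (headV e) w)) (upTo (suc ne))) (allFin ne)
      ≈⟨ Σ-cong (allFin ne) (λ e → Σ-ite-*ˡ (out e) (edgeWeight e) (upTo (suc ne))) ⟩
    Σ (λ e → ite (out e) (edgeWeight e * Σ (λ j → lengthSum j (headV e) w) (upTo (suc ne)))) (allFin ne)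
      ≈⟨ Σ-cong (allFin ne) (λ e → ite-cong (out e) (*-congˡ (pathSum≈Σ-lengthSum (headV e) w))) ⟨
    Σ (λ e → ite (out e) (edgeWeight e * pathSum (headV e) w)) (allFin ne) ∎
    where
    out : Fin ne → Bool
    out e = ⌊ tailV e ≟V u ⌋

  pathSum-first-step : ∀ u w → pathSum u w ≈
    ite ⌊ u ≟V w ⌋ 1# + Σ (λ e → ite ⌊ tailV e ≟V u ⌋ (edgeWeight e * pathSum (headV e) w)) (allFin ne)
  pathSum-first-step u w = begin
    pathSum u w                                 ≈⟨ pathSum≈Σ-lengthSum u w ⟩
    Σ L (upTo (suc ne))                         ≈⟨ Σ-upTo-suc ne ⟩
    L 0 + Σ (L ∘ suc) (upTo ne)                 ≈⟨ +-congˡ (trans (+-congˡ (lengthSum-too-long u w)) (+-identityʳ _)) ⟨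
    L 0 + (Σ (L ∘ suc) (upTo ne) + L (suc ne))  ≈⟨ +-cong (lengthSum-zero u w) (sym (Σ-upTo-∷ʳ ne)) ⟩
    ite ⌊ u ≟V w ⌋ 1# + Σ (L ∘ suc) (upTo (suc ne))
                                                ≈⟨ +-congˡ (Σ-lengthSum-suc u w) ⟩
    ite ⌊ u ≟V w ⌋ 1# + Σ (λ e → ite ⌊ tailV e ≟V u ⌋ (edgeWeight e * pathSum (headV e) w)) (allFin ne) ∎
    where
    L : ℕ → Carrier
    L j = lengthSum j u w

module VectorExpansion {c ℓ : Level} (K : Field c ℓ) {n m : ℕ} {G : BipGraph n} (plabic : IsPlabic G)
                       {bw : Fin (BipGraph.ne G) → Bool}
                       (reversePerfect : BipGraphDefs.Oriented.IsReversePerfect G bw)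
                       (acyclic : BipGraphDefs.Oriented.Acyclic G bw)
                       (C : VRC K m G) (b : BipGraphDefs.Black G) (k : Fin m) where
  open Field K
  open ListSums commutativeSemiring
  open BipGraphDefs G
  open Oriented bw
  open Orientation G bw using (head-black; source⇒no-in-edge; non-source⇒in-edge)
  open IsPlabic plabic using (bEdge; bEdge-uniq)
  open VRC C
  open PathWeights K G bw rel using (pathSum)
  open PathSums K G bw rel rel-nonzero acyclic
  open import Algebra.Properties.Ring ring using (-1*x≈-x; +-cancelʳ)
  open import Relation.Binary.Reasoning.Setoid setoid

  T : Vertex → Carrier
  T v = pathSum v (inj₁ b)

  U : Vertex → Carrier
  U (inj₁ c) = vec c k
  U (inj₂ _) = 0#

  boundarySource : Vertex → Carrier
  boundarySource (inj₁ (inj₁ i)) = ite (isSource (bdry i)) (T (bdry i) * U (bdry i))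
  boundarySource _               = 0#

  vertices : List Vertex
  vertices = map inj₁ (map inj₁ (allFin n) ++ map inj₂ (allFin nb)) ++ map inj₂ (allFin nw)

  vertices-unique : Unique vertices
  vertices-unique = inj-++-unique (inj-++-unique (Unique.allFin⁺ n) (Unique.allFin⁺ nb)) (Unique.allFin⁺ nw)

  ∈-vertices : ∀ v → v ∈ vertices
  ∈-vertices = ∈-inj-++ (∈-inj-++ ∈-allFin ∈-allFin) ∈-allFin

  outTerm inTerm relationTerm : Fin ne → Carrier
  outTerm      e = edgeWeight e * T (headV e) * U (tailV e)
  inTerm       e = T (headV e) * U (headV e)
  relationTerm e = T (wEnd e) * (rel e * vec (blackEnd e) k)

  T-white : ∀ e → bw e ≡ false → T (wEnd e) ≈ edgeWeight e * T (headV e)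
  T-white e white→black = begin
    T (wEnd e)
      ≈⟨ pathSum-first-step (wEnd e) (inj₁ b) ⟩
    0# + Σ (λ x → ite ⌊ tailV x ≟V wEnd e ⌋ (edgeWeight x * T (headV x))) (allFin ne)
      ≈⟨ +-identityˡ _ ⟩
    Σ (λ x → ite ⌊ tailV x ≟V wEnd e ⌋ (edgeWeight x * T (headV x))) (allFin ne)
      ≈⟨ Σ-ite-single (λ x → tailV x ≟V wEnd e) (Unique.allFin⁺ ne) (∈-allFin e) tail≡w only-e ⟩
    edgeWeight e * T (headV e) ∎
    where
    tail≡w : tailV e ≡ wEnd e
    tail≡w = ≡.cong (if_then bEnd e else wEnd e) white→black
    only-e : ∀ {x} → tailV x ≡ wEnd e → x ≡ e
    only-e tail-x with _ , _ , only ← count≡1⇒∃! (λ x → tailV x ≟V wEnd e) (proj₁ reversePerfect (whiteEnd e))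
      = ≡.trans (only tail-x) (≡.sym (only tail≡w))

  edge-balance : ∀ e → outTerm e ≈ relationTerm e + inTerm e
  edge-balance e with bw e | T-white e
  ... | true | _ = begin
    rel e * T (wEnd e) * V                      ≈⟨ xy∙z≈y∙xz (rel e) _ V ⟩
    T (wEnd e) * (rel e * V)                    ≈⟨ +-identityʳ _ ⟨
    T (wEnd e) * (rel e * V) + 0#               ≈⟨ +-congˡ (zeroʳ _) ⟨
    T (wEnd e) * (rel e * V) + T (wEnd e) * 0#  ∎
    where
    V = vec (blackEnd e) k
    open import Algebra.Properties.CommutativeSemigroup *-commutativeSemigroup using (xy∙z≈y∙xz)
  ... | false | T-w = begin
    (- rel e) ⁻¹ * T (bEnd e) * 0#               ≈⟨ zeroʳ _ ⟩
    0#                                           ≈⟨ -‿inverseˡ (T (bEnd e) * V) ⟨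
    - (T (bEnd e) * V) + T (bEnd e) * V          ≈⟨ +-congʳ white-term ⟨
    T (wEnd e) * (rel e * V) + T (bEnd e) * V    ∎
    where
    V = vec (blackEnd e) k
    open import Algebra.Properties.CommutativeSemigroup *-commutativeSemigroup using (interchange)
    open FieldProperties K using (x*[-x]⁻¹≈-1)
    white-term : T (wEnd e) * (rel e * V) ≈ - (T (bEnd e) * V)
    white-term = begin
      T (wEnd e) * (rel e * V)                      ≈⟨ *-congʳ (T-w ≡.refl) ⟩
      ((- rel e) ⁻¹ * T (bEnd e)) * (rel e * V)     ≈⟨ interchange _ _ _ _ ⟩
      ((- rel e) ⁻¹ * rel e) * (T (bEnd e) * V)     ≈⟨ *-congʳ (trans (*-comm _ _) (x*[-x]⁻¹≈-1 (rel-nonzero e))) ⟩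
      - 1# * (T (bEnd e) * V)                       ≈⟨ -1*x≈-x _ ⟩
      - (T (bEnd e) * V)                            ∎

  source-or-in-edge : ∀ {v} → (∀ {e e′} → headV e ≡ v → headV e′ ≡ v → e ≡ e′) → ∀ x →
                      x ≈ ite (isSource v) x + Σ (λ e → ite ⌊ headV e ≟V v ⌋ x) (allFin ne)
  source-or-in-edge {v} at-most-one x with isSource v in source?
  ... | true = sym (begin
    x + Σ (λ e → ite ⌊ headV e ≟V v ⌋ x) (allFin ne)
      ≈⟨ +-congˡ (Σ-ite-none (λ e → headV e ≟V v) (allFin ne) λ {e} _ → source⇒no-in-edge source? e) ⟩
    x + 0#
      ≈⟨ +-identityʳ x ⟩
    x ∎)
  ... | false with e , head≡v ← non-source⇒in-edge source? = sym (begin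
    0# + Σ (λ e → ite ⌊ headV e ≟V v ⌋ x) (allFin ne)
      ≈⟨ +-identityˡ _ ⟩
    Σ (λ e → ite ⌊ headV e ≟V v ⌋ x) (allFin ne)
      ≈⟨ Σ-ite-single (λ e → headV e ≟V v) (Unique.allFin⁺ ne) (∈-allFin e) head≡v (λ h → at-most-one h head≡v) ⟩
    x ∎)

  T*U-by-in-edges : ∀ v → T v * U v ≈ boundarySource v + Σ (λ e → ite ⌊ headV e ≟V v ⌋ (T v * U v)) (allFin ne)
  T*U-by-in-edges (inj₁ (inj₁ i)) = source-or-in-edge only-bEdge _
    where
    only-bEdge : ∀ {e e′} → headV e ≡ bdry i → headV e′ ≡ bdry i → e ≡ e′
    only-bEdge h h′ = ≡.trans (bEdge-uniq i _ (head-black h)) (≡.sym (bEdge-uniq i _ (head-black h′)))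
  T*U-by-in-edges (inj₁ (inj₂ j))
    with e , head≡v , only-e ← count≡1⇒∃! (λ e → headV e ≟V inj₁ (inj₂ j)) (proj₂ reversePerfect j) =
    sym (trans (+-identityˡ _)
               (Σ-ite-single (λ e → headV e ≟V inj₁ (inj₂ j)) (Unique.allFin⁺ ne) (∈-allFin e) head≡v only-e))
  T*U-by-in-edges (inj₂ w) =
    trans (zeroʳ _) (sym (trans (+-identityˡ _) (Σ-zero (allFin ne) λ e → ite-≈0 ⌊ headV e ≟V inj₂ w ⌋ (zeroʳ _))))

  T*U-by-out-edges : ∀ v → T v * U v ≈
    ite ⌊ v ≟V inj₁ b ⌋ (U v) + Σ (λ e → ite ⌊ tailV e ≟V v ⌋ (edgeWeight e * T (headV e) * U v)) (allFin ne)
  T*U-by-out-edges v = begin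
    T v * U v
      ≈⟨ *-congʳ (pathSum-first-step v (inj₁ b)) ⟩
    (ite (at-b) 1# + Σ (λ e → ite (out e) (edgeWeight e * T (headV e))) (allFin ne)) * U v
      ≈⟨ distribʳ _ _ _ ⟩
    ite (at-b) 1# * U v + Σ (λ e → ite (out e) (edgeWeight e * T (headV e))) (allFin ne) * U v
      ≈⟨ +-cong (trans (ite-*ʳ (at-b) _ _) (ite-cong (at-b) (*-identityˡ _)))
                (trans (Σ-*ʳ (U v) (allFin ne)) (Σ-cong (allFin ne) λ e → ite-*ʳ (out e) _ _)) ⟩
    ite (at-b) (U v) + Σ (λ e → ite (out e) (edgeWeight e * T (headV e) * U v)) (allFin ne) ∎
    where
    at-b : Bool
    at-b = ⌊ v ≟V inj₁ b ⌋
    out : Fin ne → Bool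
    out e = ⌊ tailV e ≟V v ⌋

  Σ-T*U-by-out-edges : Σ (λ v → T v * U v) vertices ≈ vec b k + Σ outTerm (allFin ne)
  Σ-T*U-by-out-edges = begin
    Σ (λ v → T v * U v) vertices
      ≈⟨ Σ-cong vertices T*U-by-out-edges ⟩
    Σ (λ v → ite ⌊ v ≟V inj₁ b ⌋ (U v) + Σ (λ e → out e v) (allFin ne)) vertices
      ≈⟨ Σ-+ vertices ⟩
    Σ (λ v → ite ⌊ v ≟V inj₁ b ⌋ (U v)) vertices + Σ (λ v → Σ (λ e → out e v) (allFin ne)) vertices
      ≈⟨ +-cong (Σ-ite-single (_≟V inj₁ b) vertices-unique (∈-vertices (inj₁ b)) ≡.refl (λ v≡b → v≡b))
                (Σ-fibres tailV _≟V_ (λ e v → edgeWeight e * T (headV e) * U v) (allFin ne)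
                          vertices-unique (∈-vertices ∘ tailV)) ⟩
    vec b k + Σ outTerm (allFin ne) ∎
    where
    out : Fin ne → Vertex → Carrier
    out e v = ite ⌊ tailV e ≟V v ⌋ (edgeWeight e * T (headV e) * U v)

  Σ-T*U-by-in-edges : Σ (λ v → T v * U v) vertices ≈ Σ boundarySource vertices + Σ inTerm (allFin ne)
  Σ-T*U-by-in-edges = begin
    Σ (λ v → T v * U v) vertices
      ≈⟨ Σ-cong vertices T*U-by-in-edges ⟩
    Σ (λ v → boundarySource v + Σ (λ e → ite ⌊ headV e ≟V v ⌋ (T v * U v)) (allFin ne)) vertices
      ≈⟨ Σ-+ vertices ⟩
    Σ boundarySource vertices + Σ (λ v → Σ (λ e → ite ⌊ headV e ≟V v ⌋ (T v * U v)) (allFin ne)) vertices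
      ≈⟨ +-congˡ (Σ-fibres headV _≟V_ (λ _ v → T v * U v) (allFin ne) vertices-unique (∈-vertices ∘ headV)) ⟩
    Σ boundarySource vertices + Σ inTerm (allFin ne) ∎

  Σ-relationTerm : Σ relationTerm (allFin ne) ≈ 0#
  Σ-relationTerm = sym (begin
    0#
      ≈⟨ Σ-zero (allFin nw) (λ w → trans (*-congˡ (white-rel w k)) (zeroʳ _)) ⟨
    Σ (λ w → T (inj₂ w) * Σ (λ e → ite (at w e) (rel e * vec (blackEnd e) k)) (allFin ne)) (allFin nw)
      ≈⟨ Σ-cong (allFin nw) (λ w → trans (Σ-*ˡ (T (inj₂ w)) (allFin ne))
                                         (Σ-cong (allFin ne) λ e → ite-*ˡ (at w e) _ _)) ⟩
    Σ (λ w → Σ (λ e → ite (at w e) (T (inj₂ w) * (rel e * vec (blackEnd e) k))) (allFin ne)) (allFin nw)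
      ≈⟨ Σ-fibres whiteEnd Fin._≟_ (λ e w → T (inj₂ w) * (rel e * vec (blackEnd e) k)) (allFin ne)
                  (Unique.allFin⁺ nw) (∈-allFin ∘ whiteEnd) ⟩
    Σ relationTerm (allFin ne) ∎)
    where
    at : Fin nw → Fin ne → Bool
    at w e = ⌊ whiteEnd e Fin.≟ w ⌋

  Σ-outTerm≈Σ-inTerm : Σ outTerm (allFin ne) ≈ Σ inTerm (allFin ne)
  Σ-outTerm≈Σ-inTerm = begin
    Σ outTerm (allFin ne)                                    ≈⟨ Σ-cong (allFin ne) edge-balance ⟩
    Σ (λ e → relationTerm e + inTerm e) (allFin ne)          ≈⟨ Σ-+ (allFin ne) ⟩
    Σ relationTerm (allFin ne) + Σ inTerm (allFin ne)        ≈⟨ +-congʳ Σ-relationTerm ⟩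
    0# + Σ inTerm (allFin ne)                                ≈⟨ +-identityˡ _ ⟩
    Σ inTerm (allFin ne)                                     ∎

  Σ-boundarySource : Σ boundarySource vertices ≈
                     Σ (λ i → ite (isSource (bdry i)) (T (bdry i) * vec (inj₁ i) k)) (allFin n)
  Σ-boundarySource = begin
    Σ boundarySource vertices
      ≈⟨ Σ-inj-++ (map inj₁ (allFin n) ++ map inj₂ (allFin nb)) (allFin nw) ⟩
    Σ (boundarySource ∘ inj₁) (map inj₁ (allFin n) ++ map inj₂ (allFin nb)) + Σ (λ _ → 0#) (allFin nw)
      ≈⟨ +-cong (Σ-inj-++ (allFin n) (allFin nb)) (Σ-zero (allFin nw) (λ _ → refl)) ⟩
    (Σ (boundarySource ∘ inj₁ ∘ inj₁) (allFin n) + Σ (λ _ → 0#) (allFin nb)) + 0#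
      ≈⟨ trans (+-identityʳ _) (+-congˡ (Σ-zero (allFin nb) (λ _ → refl))) ⟩
    Σ (boundarySource ∘ inj₁ ∘ inj₁) (allFin n) + 0#
      ≈⟨ +-identityʳ _ ⟩
    Σ (λ i → ite (isSource (bdry i)) (T (bdry i) * vec (inj₁ i) k)) (allFin n) ∎

  expansion : vec b k ≈ Σ (λ i → ite (isSource (bdry i)) (T (bdry i) * vec (inj₁ i) k)) (allFin n)
  expansion = trans (+-cancelʳ (Σ outTerm (allFin ne)) _ _ two-countings) Σ-boundarySource
    where
    two-countings : vec b k + Σ outTerm (allFin ne) ≈ Σ boundarySource vertices + Σ outTerm (allFin ne)
    two-countings = begin
      vec b k + Σ outTerm (allFin ne)                    ≈⟨ Σ-T*U-by-out-edges ⟨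
      Σ (λ v → T v * U v) vertices                       ≈⟨ Σ-T*U-by-in-edges ⟩
      Σ boundarySource vertices + Σ inTerm (allFin ne)   ≈⟨ +-congˡ Σ-outTerm≈Σ-inTerm ⟨
      Σ boundarySource vertices + Σ outTerm (allFin ne)  ∎

lemma3p6 : ∀ {c ℓ : Level} (K : Field c ℓ) (n m : ℕ) (G : BipGraph n) →
    IsPlabic G → BipGraphDefs.Leafless G →
    (bw : Fin (BipGraph.ne G) → Bool) →
    BipGraphDefs.Oriented.IsReversePerfect G bw →
    BipGraphDefs.Oriented.Acyclic G bw →
    (C : VRC K m G) →
    ∀ (b : BipGraphDefs.Black G) (k : Fin m) →
    Field._≈_ K (VRC.vec C b k)
      (sumL K (λ i → if BipGraphDefs.Oriented.isSource G bw (inj₁ (inj₁ i))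
                     then Field._*_ K (PathWeights.pathSum K G bw (VRC.rel C) (inj₁ (inj₁ i)) (inj₁ b)) (VRC.vec C (inj₁ i) k)
                     else Field.0# K)
        (allFin n))
lemma3p6 K n m G plabic _ bw reversePerfect acyclic C b k =
  VectorExpansion.expansion K plabic reversePerfect acyclic C b k
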